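{- Let $X$ and $Y$ be $\mathfrak{Q}$-preordered $\mathfrak{Q}$-subsets. Then the following six collections are in bijection with each other: (a) $\mathfrak{Q}$-distributors $X\nrightarrow Y$; (b) $\mathfrak{Q}$-order-preserving maps $Y\to\mathsf{P}X$; (c) $\mathfrak{Q}$-order-preserving maps $X\to\mathsf{P}^\dagger Y$; (d) $\mathfrak{Q}$-polarities from $X$ to $Y$, i.e. $\mathfrak{Q}$-Galois connections $f\dashv g$ with $f\colon\mathsf{P}X\to\mathsf{P}^\dagger Y$, $g\colon\mathsf{P}^\dagger Y\to\mathsf{P}X$; (e) $\mathfrak{Q}$-axialities from $Y$ to $X$, i.e. $\mathfrak{Q}$-Galois connections $f\dashv g$ with $f\colon\mathsf{P}Y\to\mathsf{P}X$, $g\colon\mathsf{P}X\to\mathsf{P}Y$; (f) dual $\mathfrak{Q}$-axialities from $Y$ to $X$, i.e. $\mathfrak{Q}$-Galois connections $f\dashv g$ with $f\colon\mathsf{P}^\dagger Y\to\mathsf{P}^\dagger X$, $g\colon\mathsf{P}^\dagger X\to\mathsf{P}^\dagger Y$.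
   Context: $(\mathfrak{Q},\&,e)$ is a unital quantale (complete lattice with an associative multiplication $\&$ with unit $e$, distributing over arbitrary joins in each variable), assumed non-trivial ($\bot<e$). Implications: $p\& q\le r\iff p\le r/q\iff q\le p\backslash r$. $\mathcal{D}\mathfrak{Q}(p,q)=\{u\in\mathfrak{Q}: (u/p)\& p=u=q\&(q\backslash u)\}$. A $\mathfrak{Q}$-subset is a set $X$ with a map $|\cdot|\colon X\to\mathfrak{Q}$. A $\mathfrak{Q}$-relation $\phi\colon X\nrightarrow Y$ is a map $X\times Y\to\mathfrak{Q}$ with $\phi(x,y)\in\mathcal{D}\mathfrak{Q}(|x|,|y|)$. Composition: $(\psi\circ\phi)(x,z)=\bigvee_{y}(\psi(y,z)/|y|)\&\phi(x,y)$; identity $\mathrm{id}_X(x,x')=|x|$ if $x=x'$, $\bot$ otherwise; pointwise order. $\xi\swarrow\phi$ (for $\phi\colon X\nrightarrow Y$, $\xi\colon X\nrightarrow Z$) is the join of all $\psi'\colon Y\nrightarrow Z$ with $\psi'\circ\phi\le\xi$; $\psi\searrow\xi$ (for $\psi\colon Y\nrightarrow Z$) is the join of all $\phi'\colon X\nrightarrow Y$ with $\psi\circ\phi'\le\xi$. $\mathbf{1}_q$ is the singleton $\{*\}$ with $|*|=q$. A $\mathfrak{Q}$-preordered $\mathfrak{Q}$-subset is a $\mathfrak{Q}$-subset $X$ with $1_X^\natural\colon X\nrightarrow X$, $\mathrm{id}_X\le 1_X^\natural$, $1_X^\natural\circ 1_X^\natural\le 1_X^\natural$. $\mathfrak{Q}$-order-preserving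 map: $|fx|=|x|$ and $1_X^\natural(x,x')\le 1_Y^\natural(fx,fx')$. Underlying preorder: $x\le y$ iff $|x|=|y|$ and $|x|\le 1_X^\natural(x,y)$; maps compared pointwise. $\mathfrak{Q}$-Galois connection $f\dashv g$: $\mathfrak{Q}$-order-preserving $f,g$ with $1\le gf$, $fg\le 1$. $\mathfrak{Q}$-distributor $\phi\colon X\nrightarrow Y$: $\mathfrak{Q}$-relation with $1_Y^\natural\circ\phi\circ 1_X^\natural\le\phi$. $\mathsf{P}X$: all $\mu\colon X\nrightarrow\mathbf{1}_q$ ($q\in\mathfrak{Q}$) with $\mu\circ 1_X^\natural\le\mu$, $|\mu|=q$, $1_{\mathsf{P}X}^\natural(\mu,\mu')=\mu'\swarrow\mu$. $\mathsf{P}^\dagger X$: all $\lambda\colon\mathbf{1}_q\nrightarrow X$ with $1_X^\natural\circ\lambda\le\lambda$, $|\lambda|=q$, $1_{\mathsf{P}^\dagger X}^\natural(\lambda,\lambda')=\lambda'\searrow\lambda$. -}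

module Defs where

open import Level using (0ℓ)
open import Data.Empty renaming (⊥ to Empty)
open import Data.Unit using (⊤; tt)
open import Data.Product using (Σ; _×_; _,_; proj₁; proj₂)
open import Relation.Nullary using (¬_)
open import Relation.Binary.PropositionalEquality using (_≡_; refl; sym; trans; cong₂)
open import Relation.Binary.Structures using (IsPartialOrder; IsEquivalence)
open import Relation.Binary.Bundles using (Setoid)

record Quantale : Set₁ where
  infixl 7 _&_
  infix 4 _≤_
  field
    Carrier        : Set
    _≤_            : Carrier → Carrier → Set
    isPartialOrder : IsPartialOrder _≡_ _≤_
    ⋁              : {I : Set} → (I → Carrier) → Carrier
    ⋁-upper        : {I : Set} (f : I → Carrier) (i : I) → f i ≤ ⋁ f
    ⋁-least        : {I : Set} (f : I → Carrier) (a : Carrier) →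
                     ((i : I) → f i ≤ a) → ⋁ f ≤ a
    _&_            : Carrier → Carrier → Carrier
    e              : Carrier
    &-assoc        : ∀ p q r → (p & q) & r ≡ p & (q & r)
    &-identityˡ    : ∀ p → e & p ≡ p
    &-identityʳ    : ∀ p → p & e ≡ p
    &-distribˡ-⋁   : {I : Set} (p : Carrier) (f : I → Carrier) →
                     p & ⋁ f ≡ ⋁ (λ i → p & f i)
    &-distribʳ-⋁   : {I : Set} (f : I → Carrier) (p : Carrier) →
                     ⋁ f & p ≡ ⋁ (λ i → f i & p)

  bot : Carrier
  bot = ⋁ {I = Empty} (λ ())

  -- left and right implications:  p & q ≤ r  iff  p ≤ r / q  iff  q ≤ p \ r
  _/_ : Carrier → Carrier → Carrier
  r / q = ⋁ {I = Σ Carrier (λ p → p & q ≤ r)} proj₁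

  _\\_ : Carrier → Carrier → Carrier
  p \\ r = ⋁ {I = Σ Carrier (λ q → p & q ≤ r)} proj₁

  _<_ : Carrier → Carrier → Set
  p < q = (p ≤ q) × ¬ (p ≡ q)

  InD : Carrier → Carrier → Carrier → Set
  InD p q u = (((u / p) & p) ≡ u) × ((q & (q \\ u)) ≡ u)

Nontrivial : Quantale → Set
Nontrivial 𝔔 = Quantale._<_ 𝔔 (Quantale.bot 𝔔) (Quantale.e 𝔔)

module _ (𝔔 : Quantale) where
  open Quantale 𝔔

  record QSubset : Set₁ where
    field
      Elt : Set
      ∣_∣ : Elt → Carrier
  open QSubset public

  RawRel : QSubset → QSubset → Set
  RawRel X Y = Elt X → Elt Y → Carrier

  LeqR : (X Y : QSubset) → RawRel X Y → RawRel X Y → Set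
  LeqR X Y φ ψ = (x : Elt X) (y : Elt Y) → φ x y ≤ ψ x y

  record QRel (X Y : QSubset) : Set where
    field
      rel : RawRel X Y
      inD : (x : Elt X) (y : Elt Y) → InD (∣ X ∣ x) (∣ Y ∣ y) (rel x y)
  open QRel public

  comp : (X Y Z : QSubset) → RawRel Y Z → RawRel X Y → RawRel X Z
  comp X Y Z ψ φ x z = ⋁ (λ (y : Elt Y) → (ψ y z / ∣ Y ∣ y) & φ x y)

  -- identity relation (the "x = x'" case split is expressed as a join over x ≡ x')
  idR : (X : QSubset) → RawRel X X
  idR X x x' = ⋁ {I = x ≡ x'} (λ _ → ∣ X ∣ x)

  lift : (X Y Z : QSubset) → RawRel X Z → RawRel X Y → RawRel Y Z
  lift X Y Z ξ φ y z =
    ⋁ {I = Σ (QRel Y Z) (λ ψ' → LeqR X Z (comp X Y Z (rel ψ') φ) ξ)} (λ p → rel (proj₁ p) y z)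

  ext : (X Y Z : QSubset) → RawRel Y Z → RawRel X Z → RawRel X Y
  ext X Y Z ψ ξ x y =
    ⋁ {I = Σ (QRel X Y) (λ φ' → LeqR X Z (comp X Y Z ψ (rel φ')) ξ)} (λ p → rel (proj₁ p) x y)

  one : Carrier → QSubset
  one q = record { Elt = ⊤ ; ∣_∣ = λ _ → q }

  record QPre : Set₁ where
    field
      sub : QSubset
      hom : RawRel sub sub
  open QPre public

  record QPreordered : Set₁ where
    field
      pre     : QPre
      homRel  : (x x' : Elt (sub pre)) →
                InD (∣ sub pre ∣ x) (∣ sub pre ∣ x') (hom pre x x')
      homRefl : LeqR (sub pre) (sub pre) (idR (sub pre)) (hom pre)
      homTran : LeqR (sub pre) (sub pre)
                  (comp (sub pre) (sub pre) (sub pre) (hom pre) (hom pre)) (hom pre)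
  open QPreordered public

  record OPMap (A B : QPre) : Set where
    field
      fun  : Elt (sub A) → Elt (sub B)
      pres : (a : Elt (sub A)) → ∣ sub B ∣ (fun a) ≡ ∣ sub A ∣ a
      mono : (a a' : Elt (sub A)) → hom A a a' ≤ hom B (fun a) (fun a')
  open OPMap public

  Below : (A : QPre) → Elt (sub A) → Elt (sub A) → Set
  Below A x y = (∣ sub A ∣ x ≡ ∣ sub A ∣ y) × (∣ sub A ∣ x ≤ hom A x y)

  record Galois (A B : QPre) : Set where
    field
      left    : OPMap A B
      right   : OPMap B A
      unit    : (a : Elt (sub A)) → Below A a (fun right (fun left a))
      counit  : (b : Elt (sub B)) → Below B (fun left (fun right b)) b
  open Galois public

  record Distributor (X Y : QPreordered) : Set where
    field
      qrel : QRel (sub (pre X)) (sub (pre Y))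
      dist : LeqR (sub (pre X)) (sub (pre Y))
               (comp (sub (pre X)) (sub (pre X)) (sub (pre Y))
                  (comp (sub (pre X)) (sub (pre Y)) (sub (pre Y)) (hom (pre Y)) (rel qrel))
                  (hom (pre X)))
               (rel qrel)
  open Distributor public

  PElt : QPreordered → Set
  PElt X = Σ Carrier (λ q → Σ (QRel (sub (pre X)) (one q)) (λ μ →
             LeqR (sub (pre X)) (one q)
               (comp (sub (pre X)) (sub (pre X)) (one q) (rel μ) (hom (pre X))) (rel μ)))

  𝖯 : QPreordered → QPre
  𝖯 X = record
    { sub = record { Elt = PElt X ; ∣_∣ = proj₁ }
    ; hom = λ { (q , μ , _) (q' , μ' , _) →
                  lift (sub (pre X)) (one q) (one q') (rel μ') (rel μ) tt tt }
    }

  P†Elt : QPreordered → Set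
  P†Elt X = Σ Carrier (λ q → Σ (QRel (one q) (sub (pre X))) (λ λ₀ →
              LeqR (one q) (sub (pre X))
                (comp (one q) (sub (pre X)) (sub (pre X)) (hom (pre X)) (rel λ₀)) (rel λ₀)))

  𝖯† : QPreordered → QPre
  𝖯† X = record
    { sub = record { Elt = P†Elt X ; ∣_∣ = proj₁ }
    ; hom = λ { (q , λ₀ , _) (q' , λ₁ , _) →
                  ext (one q) (one q') (sub (pre X)) (rel λ₁) (rel λ₀) tt tt }
    }

  EqP : (X : QPreordered) → PElt X → PElt X → Set
  EqP X (q , μ , _) (q' , μ' , _) =
    (q ≡ q') × ((x : Elt (sub (pre X))) → rel μ x tt ≡ rel μ' x tt)

  ≈P-equiv : (X : QPreordered) → IsEquivalence (EqP X)
  ≈P-equiv X = record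
    { refl  = refl , λ _ → refl
    ; sym   = λ (a , b) → sym a , λ x → sym (b x)
    ; trans = λ (a , b) (c , d) → trans a c , λ x → trans (b x) (d x)
    }

  EqP† : (X : QPreordered) → P†Elt X → P†Elt X → Set
  EqP† X (q , λ₀ , _) (q' , λ₁ , _) =
    (q ≡ q') × ((x : Elt (sub (pre X))) → rel λ₀ tt x ≡ rel λ₁ tt x)

  ≈P†-equiv : (X : QPreordered) → IsEquivalence (EqP† X)
  ≈P†-equiv X = record
    { refl  = refl , λ _ → refl
    ; sym   = λ (a , b) → sym a , λ x → sym (b x)
    ; trans = λ (a , b) (c , d) → trans a c , λ x → trans (b x) (d x)
    }

  DistSetoid : QPreordered → QPreordered → Setoid 0ℓ 0ℓ
  DistSetoid X Y = record
    { Carrier = Distributor X Y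
    ; _≈_ = λ φ ψ → (x : Elt (sub (pre X))) (y : Elt (sub (pre Y))) →
                    rel (qrel φ) x y ≡ rel (qrel ψ) x y
    ; isEquivalence = record
        { refl = λ _ _ → refl
        ; sym = λ p x y → sym (p x y)
        ; trans = λ p q x y → trans (p x y) (q x y) }
    }

  MapSetoid : (A B : QPre) (_≈_ : Elt (sub B) → Elt (sub B) → Set) →
              IsEquivalence _≈_ → Setoid 0ℓ 0ℓ
  MapSetoid A B _≈_ eq = record
    { Carrier = OPMap A B
    ; _≈_ = λ f g → (a : Elt (sub A)) → fun f a ≈ fun g a
    ; isEquivalence = record
        { refl = λ _ → IsEquivalence.refl eq
        ; sym = λ p a → IsEquivalence.sym eq (p a)
        ; trans = λ p q a → IsEquivalence.trans eq (p a) (q a) }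
    }

  GaloisSetoid : (A B : QPre)
                 (_≈A_ : Elt (sub A) → Elt (sub A) → Set) → IsEquivalence _≈A_ →
                 (_≈B_ : Elt (sub B) → Elt (sub B) → Set) → IsEquivalence _≈B_ →
                 Setoid 0ℓ 0ℓ
  GaloisSetoid A B _≈A_ eA _≈B_ eB = record
    { Carrier = Galois A B
    ; _≈_ = λ c d → ((a : Elt (sub A)) → fun (left c) a ≈B fun (left d) a)
                  × ((b : Elt (sub B)) → fun (right c) b ≈A fun (right d) b)
    ; isEquivalence = record
        { refl = (λ _ → IsEquivalence.refl eB) , (λ _ → IsEquivalence.refl eA)
        ; sym = λ (p , q) → (λ a → IsEquivalence.sym eB (p a)) , (λ b → IsEquivalence.sym eA (q b))
        ; trans = λ (p , q) (r , s) → (λ a → IsEquivalence.trans eB (p a) (r a))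
                                    , (λ b → IsEquivalence.trans eA (q b) (s b)) }
    }

  MapsToP : QPreordered → QPreordered → Setoid 0ℓ 0ℓ
  MapsToP X Y = MapSetoid (pre Y) (𝖯 X) (EqP X) (≈P-equiv X)

  MapsToP† : QPreordered → QPreordered → Setoid 0ℓ 0ℓ
  MapsToP† X Y = MapSetoid (pre X) (𝖯† Y) (EqP† Y) (≈P†-equiv Y)

  Polarities : QPreordered → QPreordered → Setoid 0ℓ 0ℓ
  Polarities X Y = GaloisSetoid (𝖯 X) (𝖯† Y) (EqP X) (≈P-equiv X) (EqP† Y) (≈P†-equiv Y)

  Axialities : QPreordered → QPreordered → Setoid 0ℓ 0ℓ
  Axialities Y X = GaloisSetoid (𝖯 Y) (𝖯 X) (EqP Y) (≈P-equiv Y) (EqP X) (≈P-equiv X)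

  DualAxialities : QPreordered → QPreordered → Setoid 0ℓ 0ℓ
  DualAxialities Y X = GaloisSetoid (𝖯† Y) (𝖯† X) (EqP† Y) (≈P†-equiv Y) (EqP† X) (≈P†-equiv X)

-- Everything happens in the calculus of 𝔔-relations: composition ⊙ and the residuations
-- ξ ↙ φ and ψ ↘ ξ, right adjoint to composition on either side.  A distributor φ : X ⇸ Y
-- gives its columns Y → 𝖯X and rows X → 𝖯†Y, the polarity μ ↦ φ ↙ μ ⊣ λ ↦ λ ↘ φ, the
-- axiality μ ↦ μ ⊙ φ ⊣ ν ↦ ν ↙ φ and the dual axiality λ ↦ φ ↘ λ ⊣ κ ↦ φ ⊙ κ.  Conversely,
-- a map or Galois connection is restricted along a Yoneda embedding y; the Yoneda lemma
-- (lifting or extending along a representable is evaluation) shows that this recovers φ.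
-- It also recovers the Galois connection: for f ⊣ g out of 𝖯X, (g b)(x) = 𝖯X(y x, g b) =
-- B(f (y x), b), so g, and with it f, is determined by f ∘ y; dually for 𝖯†.

module Submission where

open import Defs
open import Level using (0ℓ)
open import Data.Bool using (Bool; true; false)
open import Data.Product using (_×_; Σ; _,_; proj₁; proj₂)
open import Data.Unit using (⊤; tt)
open import Function.Bundles using (Inverse)
open import Relation.Binary.Bundles using (Poset; Setoid)
open import Relation.Binary.PropositionalEquality
  using (_≡_; refl; sym; trans; cong; subst; module ≡-Reasoning)
import Relation.Binary.Reasoning.PartialOrder as PartialOrderReasoning

module QuantaleArithmetic (𝔔 : Quantale) where
  open Quantale 𝔔

  poset : Poset 0ℓ 0ℓ 0ℓ
  poset = record { isPartialOrder = isPartialOrder }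

  open Poset poset public
    using (antisym) renaming (refl to ≤-refl; trans to ≤-trans; reflexive to ≤-reflexive)
  module ≤-Reasoning = PartialOrderReasoning poset

  ⋁-mono : ∀ {I : Set} {f g : I → Carrier} → (∀ i → f i ≤ g i) → ⋁ f ≤ ⋁ g
  ⋁-mono {f = f} {g} f≤g = ⋁-least f (⋁ g) (λ i → ≤-trans (f≤g i) (⋁-upper g i))

  ⋁-cong : ∀ {I : Set} {f g : I → Carrier} → (∀ i → f i ≡ g i) → ⋁ f ≡ ⋁ g
  ⋁-cong f≡g = antisym (⋁-mono (λ i → ≤-reflexive (f≡g i))) (⋁-mono (λ i → ≤-reflexive (sym (f≡g i))))

  ⋁-⊤ : (f : ⊤ → Carrier) → ⋁ f ≡ f tt
  ⋁-⊤ f = antisym (⋁-least f (f tt) (λ _ → ≤-refl)) (⋁-upper f tt)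

  ⋁-comm : ∀ {I J : Set} (f : I → J → Carrier) → ⋁ (λ i → ⋁ (λ j → f i j)) ≡ ⋁ (λ j → ⋁ (λ i → f i j))
  ⋁-comm f = antisym
    (⋁-least _ _ λ i → ⋁-least _ _ λ j →
      ≤-trans (⋁-upper (λ i' → f i' j) i) (⋁-upper (λ j' → ⋁ (λ i' → f i' j')) j))
    (⋁-least _ _ λ j → ⋁-least _ _ λ i →
      ≤-trans (⋁-upper (λ j' → f i j') j) (⋁-upper (λ i' → ⋁ (λ j' → f i' j')) i))

  -- Monotonicity of & comes from distributivity over the two-element join a ∨ b, which is b when a ≤ b.
  private
    pair : Carrier → Carrier → Bool → Carrier
    pair a b true  = a
    pair a b false = b

    ⋁-pair : ∀ {a b} → a ≤ b → ⋁ (pair a b) ≡ b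
    ⋁-pair {a} {b} a≤b =
      antisym (⋁-least _ b λ { true → a≤b ; false → ≤-refl }) (⋁-upper (pair a b) false)

  &-monoˡ : ∀ {a b} c → a ≤ b → a & c ≤ b & c
  &-monoˡ {a} {b} c a≤b = ≤-trans (⋁-upper (λ i → pair a b i & c) true)
    (≤-reflexive (trans (sym (&-distribʳ-⋁ (pair a b) c)) (cong (_& c) (⋁-pair a≤b))))

  &-monoʳ : ∀ {a b} c → a ≤ b → c & a ≤ c & b
  &-monoʳ {a} {b} c a≤b = ≤-trans (⋁-upper (λ i → c & pair a b i) true)
    (≤-reflexive (trans (sym (&-distribˡ-⋁ c (pair a b))) (cong (c &_) (⋁-pair a≤b))))

  &-mono : ∀ {a b c d} → a ≤ b → c ≤ d → a & c ≤ b & d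
  &-mono {b = b} {c = c} a≤b c≤d = ≤-trans (&-monoˡ c a≤b) (&-monoʳ b c≤d)

  /-intro : ∀ {p q r} → p & q ≤ r → p ≤ r / q
  /-intro {p} {q} {r} h = ⋁-upper {I = Σ Carrier (λ p → p & q ≤ r)} proj₁ (p , h)

  /-counit : ∀ {q r} → (r / q) & q ≤ r
  /-counit {q} {r} = ≤-trans (≤-reflexive (&-distribʳ-⋁ proj₁ q)) (⋁-least _ r proj₂)

  \\-intro : ∀ {p q r} → p & q ≤ r → q ≤ p \\ r
  \\-intro {p} {q} {r} h = ⋁-upper {I = Σ Carrier (λ q → p & q ≤ r)} proj₁ (q , h)

  \\-counit : ∀ {p r} → p & (p \\ r) ≤ r
  \\-counit {p} {r} = ≤-trans (≤-reflexive (&-distribˡ-⋁ p proj₁)) (⋁-least _ r proj₂)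

  /-mono : ∀ {q r u} → r ≤ u → r / q ≤ u / q
  /-mono r≤u = /-intro (≤-trans /-counit r≤u)

  \\-mono : ∀ {p r u} → r ≤ u → p \\ r ≤ p \\ u
  \\-mono r≤u = \\-intro (≤-trans \\-counit r≤u)

  HasRightFactor : Carrier → Carrier → Set
  HasRightFactor p u = (u / p) & p ≡ u

  HasLeftFactor : Carrier → Carrier → Set
  HasLeftFactor q u = q & (q \\ u) ≡ u

  hasRightFactor : ∀ {p u} → u ≤ (u / p) & p → HasRightFactor p u
  hasRightFactor = antisym /-counit

  hasLeftFactor : ∀ {q u} → u ≤ q & (q \\ u) → HasLeftFactor q u
  hasLeftFactor = antisym \\-counit

  hasRightFactor-refl : ∀ {q} → HasRightFactor q q
  hasRightFactor-refl {q} = hasRightFactor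
    (≤-trans (≤-reflexive (sym (&-identityˡ q))) (&-monoˡ q (/-intro (≤-reflexive (&-identityˡ q)))))

  hasLeftFactor-refl : ∀ {q} → HasLeftFactor q q
  hasLeftFactor-refl {q} = hasLeftFactor
    (≤-trans (≤-reflexive (sym (&-identityʳ q))) (&-monoʳ q (\\-intro (≤-reflexive (&-identityʳ q)))))

  ⋁-hasRightFactor : ∀ {I : Set} {p} (f : I → Carrier) → (∀ i → HasRightFactor p (f i)) → HasRightFactor p (⋁ f)
  ⋁-hasRightFactor {p = p} f hf = hasRightFactor (⋁-least f _ λ i →
    ≤-trans (≤-reflexive (sym (hf i))) (&-monoˡ p (/-mono (⋁-upper f i))))

  ⋁-hasLeftFactor : ∀ {I : Set} {q} (f : I → Carrier) → (∀ i → HasLeftFactor q (f i)) → HasLeftFactor q (⋁ f)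
  ⋁-hasLeftFactor {q = q} f hf = hasLeftFactor (⋁-least f _ λ i →
    ≤-trans (≤-reflexive (sym (hf i))) (&-monoʳ q (\\-mono (⋁-upper f i))))

  &-hasRightFactor : ∀ {p u} a → HasRightFactor p u → HasRightFactor p (a & u)
  &-hasRightFactor {p} {u} a hu = hasRightFactor (≤-trans
    (≤-reflexive (trans (cong (a &_) (sym hu)) (sym (&-assoc a (u / p) p))))
    (&-monoˡ p (/-intro (≤-reflexive (trans (&-assoc a (u / p) p) (cong (a &_) hu))))))

  &-hasLeftFactor : ∀ {q u} a → HasLeftFactor q u → HasLeftFactor q (u & a)
  &-hasLeftFactor {q} {u} a hu = hasLeftFactor (≤-trans
    (≤-reflexive (trans (cong (_& a) (sym hu)) (&-assoc q (q \\ u) a)))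
    (&-monoʳ q (\\-intro (≤-reflexive (trans (sym (&-assoc q (q \\ u) a)) (cong (_& a) hu))))))

  /-&-≡-&-\\ : ∀ {p u a} → HasRightFactor p u → HasLeftFactor p a → (u / p) & a ≡ u & (p \\ a)
  /-&-≡-&-\\ {p} {u} {a} hu ha = begin
    (u / p) & a                 ≡⟨ cong ((u / p) &_) (sym ha) ⟩
    (u / p) & (p & (p \\ a))    ≡⟨ sym (&-assoc (u / p) p (p \\ a)) ⟩
    ((u / p) & p) & (p \\ a)    ≡⟨ cong (_& (p \\ a)) hu ⟩
    u & (p \\ a)                ∎
    where open ≡-Reasoning

  /-self-& : ∀ {q u} → HasLeftFactor q u → (q / q) & u ≡ u
  /-self-& hu = trans (/-&-≡-&-\\ hasRightFactor-refl hu) hu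

  &/-cancel : ∀ {p u a} → HasLeftFactor p u → ((a & p) / p) & u ≡ a & u
  &/-cancel {p} {u} {a} hu = begin
    ((a & p) / p) & u      ≡⟨ /-&-≡-&-\\ (&-hasRightFactor a hasRightFactor-refl) hu ⟩
    (a & p) & (p \\ u)     ≡⟨ &-assoc a p (p \\ u) ⟩
    a & (p & (p \\ u))     ≡⟨ cong (a &_) hu ⟩
    a & u                  ∎
    where open ≡-Reasoning

  ≤-/-& : ∀ {p u b} → HasRightFactor p u → p ≤ b → u ≤ (u / p) & b
  ≤-/-& {u = u} hu p≤b = ≤-trans (≤-reflexive (sym hu)) (&-monoʳ (u / _) p≤b)

module RelationCalculus (𝔔 : Quantale) where
  open Quantale 𝔔
  open QuantaleArithmetic 𝔔

  infix  4 _⊑_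
  infixr 9 _⊙_
  infix  10 _↙_ _↘_
  infixl 30 _⟨_,_⟩

  -- Rel wraps QRel without η, so that ψ ⊙ φ, ξ ↙ φ, ψ ↘ ξ stay neutral and Agda can infer
  -- the relations occurring in an inequality between such terms.
  record Rel (X Y : QSubset 𝔔) : Set where
    no-eta-equality
    field ⌞_⌟ : QRel 𝔔 X Y
  open Rel public

  private variable
    W X Y Z : QSubset 𝔔

  _⟨_,_⟩ : Rel X Y → Elt X → Elt Y → Carrier
  φ ⟨ x , y ⟩ = rel ⌞ φ ⌟ x y

  rightFactor : (φ : Rel X Y) → ∀ x y → HasRightFactor (∣ X ∣ x) (φ ⟨ x , y ⟩)
  rightFactor φ x y = proj₁ (inD ⌞ φ ⌟ x y)

  leftFactor : (φ : Rel X Y) → ∀ x y → HasLeftFactor (∣ Y ∣ y) (φ ⟨ x , y ⟩)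
  leftFactor φ x y = proj₂ (inD ⌞ φ ⌟ x y)

  record _⊑_ (φ ψ : Rel X Y) : Set where
    constructor pointwise
    field ⊑⇒≤ : ∀ x y → φ ⟨ x , y ⟩ ≤ ψ ⟨ x , y ⟩
  open _⊑_ public

  ⊑-refl : {φ : Rel X Y} → φ ⊑ φ
  ⊑-refl = pointwise λ _ _ → ≤-refl

  ⊑-trans : {φ ψ χ : Rel X Y} → φ ⊑ ψ → ψ ⊑ χ → φ ⊑ χ
  ⊑-trans φ⊑ψ ψ⊑χ = pointwise λ x y → ≤-trans (⊑⇒≤ φ⊑ψ x y) (⊑⇒≤ ψ⊑χ x y)

  _⊙_ : Rel Y Z → Rel X Y → Rel X Z
  ⌞ _⊙_ {Y} {Z} {X} ψ φ ⌟ = record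
    { rel = comp 𝔔 X Y Z (rel ⌞ ψ ⌟) (rel ⌞ φ ⌟)
    ; inD = λ x z →
        ⋁-hasRightFactor _ (λ y → &-hasRightFactor _ (rightFactor φ x y))
      , ⋁-hasLeftFactor _ (λ y →
          subst (HasLeftFactor (∣ Z ∣ z)) (sym (/-&-≡-&-\\ (rightFactor ψ y z) (leftFactor φ x y)))
                (&-hasLeftFactor _ (leftFactor ψ y z))) }

  _↙_ : Rel X Z → Rel X Y → Rel Y Z
  ⌞ _↙_ {X} {Z} {Y} ξ φ ⌟ = record
    { rel = lift 𝔔 X Y Z (rel ⌞ ξ ⌟) (rel ⌞ φ ⌟)
    ; inD = λ y z → ⋁-hasRightFactor _ (λ ψ → proj₁ (inD (proj₁ ψ) y z))
                  , ⋁-hasLeftFactor _ (λ ψ → proj₂ (inD (proj₁ ψ) y z)) }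

  _↘_ : Rel Y Z → Rel X Z → Rel X Y
  ⌞ _↘_ {Y} {Z} {X} ψ ξ ⌟ = record
    { rel = ext 𝔔 X Y Z (rel ⌞ ψ ⌟) (rel ⌞ ξ ⌟)
    ; inD = λ x y → ⋁-hasRightFactor _ (λ φ → proj₁ (inD (proj₁ φ) x y))
                  , ⋁-hasLeftFactor _ (λ φ → proj₂ (inD (proj₁ φ) x y)) }

  ⊙-mono : {ψ ψ' : Rel Y Z} {φ φ' : Rel X Y} → ψ ⊑ ψ' → φ ⊑ φ' → ψ ⊙ φ ⊑ ψ' ⊙ φ'
  ⊙-mono ψ⊑ψ' φ⊑φ' = pointwise λ x z → ⋁-mono λ y → &-mono (/-mono (⊑⇒≤ ψ⊑ψ' y z)) (⊑⇒≤ φ⊑φ' x y)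

  ⊙-monoˡ : {ψ ψ' : Rel Y Z} {φ : Rel X Y} → ψ ⊑ ψ' → ψ ⊙ φ ⊑ ψ' ⊙ φ
  ⊙-monoˡ ψ⊑ψ' = ⊙-mono ψ⊑ψ' ⊑-refl

  ⊙-monoʳ : {ψ : Rel Y Z} {φ φ' : Rel X Y} → φ ⊑ φ' → ψ ⊙ φ ⊑ ψ ⊙ φ'
  ⊙-monoʳ = ⊙-mono ⊑-refl

  ⊙-assoc : (χ : Rel Y Z) (ψ : Rel X Y) (φ : Rel W X) →
            ∀ w z → ((χ ⊙ ψ) ⊙ φ) ⟨ w , z ⟩ ≡ (χ ⊙ (ψ ⊙ φ)) ⟨ w , z ⟩
  ⊙-assoc {Y} {Z} {X} χ ψ φ w z = begin
      ⋁ (λ x → (⋁ (λ y → χ/ y & ψ ⟨ x , y ⟩) / ∣ X ∣ x) & φ ⟨ w , x ⟩)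
    ≡⟨ ⋁-cong regroup ⟩
      ⋁ (λ x → ⋁ (λ y → χ/ y & ((ψ ⟨ x , y ⟩ / ∣ X ∣ x) & φ ⟨ w , x ⟩)))
    ≡⟨ ⋁-comm _ ⟩
      ⋁ (λ y → ⋁ (λ x → χ/ y & ((ψ ⟨ x , y ⟩ / ∣ X ∣ x) & φ ⟨ w , x ⟩)))
    ≡⟨ ⋁-cong (λ y → sym (&-distribˡ-⋁ (χ/ y) _)) ⟩
      ⋁ (λ y → χ/ y & ⋁ (λ x → (ψ ⟨ x , y ⟩ / ∣ X ∣ x) & φ ⟨ w , x ⟩))
    ∎
    where
    open ≡-Reasoning
    χ/ : Elt Y → Carrier
    χ/ y = χ ⟨ y , z ⟩ / ∣ Y ∣ y

    -- Each ψ x y is  (ψ x y / |x|) & |x|, and the |x| cancels against φ w x.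
    regroup : ∀ x → (⋁ (λ y → χ/ y & ψ ⟨ x , y ⟩) / ∣ X ∣ x) & φ ⟨ w , x ⟩
                  ≡ ⋁ (λ y → χ/ y & ((ψ ⟨ x , y ⟩ / ∣ X ∣ x) & φ ⟨ w , x ⟩))
    regroup x = begin
        (⋁ (λ y → χ/ y & ψ ⟨ x , y ⟩) / p) & φ ⟨ w , x ⟩
      ≡⟨ cong (λ t → (t / p) & φ ⟨ w , x ⟩) factor-p ⟩
        ((A & p) / p) & φ ⟨ w , x ⟩
      ≡⟨ &/-cancel (leftFactor φ w x) ⟩
        A & φ ⟨ w , x ⟩
      ≡⟨ &-distribʳ-⋁ _ (φ ⟨ w , x ⟩) ⟩
        ⋁ (λ y → (χ/ y & (ψ ⟨ x , y ⟩ / p)) & φ ⟨ w , x ⟩)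
      ≡⟨ ⋁-cong (λ y → &-assoc (χ/ y) (ψ ⟨ x , y ⟩ / p) (φ ⟨ w , x ⟩)) ⟩
        ⋁ (λ y → χ/ y & ((ψ ⟨ x , y ⟩ / p) & φ ⟨ w , x ⟩))
      ∎
      where
      p = ∣ X ∣ x
      A = ⋁ (λ y → χ/ y & (ψ ⟨ x , y ⟩ / p))
      factor-p : ⋁ (λ y → χ/ y & ψ ⟨ x , y ⟩) ≡ A & p
      factor-p = trans
        (⋁-cong λ y → trans (cong (χ/ y &_) (sym (rightFactor ψ x y))) (sym (&-assoc (χ/ y) (ψ ⟨ x , y ⟩ / p) p)))
        (sym (&-distribʳ-⋁ _ p))

  ⊙-assocˡ : {χ : Rel Y Z} {ψ : Rel X Y} {φ : Rel W X} → (χ ⊙ ψ) ⊙ φ ⊑ χ ⊙ (ψ ⊙ φ)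
  ⊙-assocˡ {χ = χ} {ψ} {φ} = pointwise λ w z → ≤-reflexive (⊙-assoc χ ψ φ w z)

  ⊙-assocʳ : {χ : Rel Y Z} {ψ : Rel X Y} {φ : Rel W X} → χ ⊙ (ψ ⊙ φ) ⊑ (χ ⊙ ψ) ⊙ φ
  ⊙-assocʳ {χ = χ} {ψ} {φ} = pointwise λ w z → ≤-reflexive (sym (⊙-assoc χ ψ φ w z))

  module _ {ξ : Rel X Z} {φ : Rel X Y} where

    ↙-universal : {ψ : Rel Y Z} → ψ ⊙ φ ⊑ ξ → ψ ⊑ ξ ↙ φ
    ↙-universal {ψ} ψφ⊑ξ = pointwise λ y z → ⋁-upper (λ ψ' → rel (proj₁ ψ') y z) (⌞ ψ ⌟ , ⊑⇒≤ ψφ⊑ξ)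

    -- Moving the division by |y| from ξ ↙ φ onto φ lets the join defining ξ ↙ φ be pulled out.
    ↙-counit : ξ ↙ φ ⊙ φ ⊑ ξ
    ↙-counit = pointwise λ x z → ⋁-least _ _ λ y → begin
        ((ξ ↙ φ) ⟨ y , z ⟩ / ∣ Y ∣ y) & φ ⟨ x , y ⟩
      ≡⟨ /-&-≡-&-\\ (rightFactor (ξ ↙ φ) y z) (leftFactor φ x y) ⟩
        (ξ ↙ φ) ⟨ y , z ⟩ & (∣ Y ∣ y \\ φ ⟨ x , y ⟩)
      ≡⟨ &-distribʳ-⋁ _ _ ⟩
        ⋁ (λ ψ → rel (proj₁ ψ) y z & (∣ Y ∣ y \\ φ ⟨ x , y ⟩))
      ≡⟨ ⋁-cong (λ ψ → sym (/-&-≡-&-\\ (proj₁ (inD (proj₁ ψ) y z)) (leftFactor φ x y))) ⟩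
        ⋁ (λ ψ → (rel (proj₁ ψ) y z / ∣ Y ∣ y) & φ ⟨ x , y ⟩)
      ≤⟨ ⋁-least _ _ (λ ψ → ≤-trans (⋁-upper (λ y' → (rel (proj₁ ψ) y' z / ∣ Y ∣ y') & φ ⟨ x , y' ⟩) y)
                                      (proj₂ ψ x z)) ⟩
        ξ ⟨ x , z ⟩
      ∎
      where open ≤-Reasoning

  module _ {ψ : Rel Y Z} {ξ : Rel X Z} where

    ↘-universal : {φ : Rel X Y} → ψ ⊙ φ ⊑ ξ → φ ⊑ ψ ↘ ξ
    ↘-universal {φ} ψφ⊑ξ = pointwise λ x y → ⋁-upper (λ φ' → rel (proj₁ φ') x y) (⌞ φ ⌟ , ⊑⇒≤ ψφ⊑ξ)

    ↘-counit : ψ ⊙ ψ ↘ ξ ⊑ ξ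
    ↘-counit = pointwise λ x z → ⋁-least _ _ λ y → ≤-trans (≤-reflexive (&-distribˡ-⋁ _ _))
      (⋁-least _ _ λ φ → ≤-trans (⋁-upper (λ y' → (ψ ⟨ y' , z ⟩ / ∣ Y ∣ y') & rel (proj₁ φ) x y') y) (proj₂ φ x z))

  ↙-mono : {ξ ξ' : Rel X Z} {φ φ' : Rel X Y} → ξ ⊑ ξ' → φ' ⊑ φ → ξ ↙ φ ⊑ ξ' ↙ φ'
  ↙-mono ξ⊑ξ' φ'⊑φ = ↙-universal (⊑-trans (⊙-monoʳ φ'⊑φ) (⊑-trans ↙-counit ξ⊑ξ'))

  ↘-mono : {ψ ψ' : Rel Y Z} {ξ ξ' : Rel X Z} → ψ' ⊑ ψ → ξ ⊑ ξ' → ψ ↘ ξ ⊑ ψ' ↘ ξ'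
  ↘-mono ψ'⊑ψ ξ⊑ξ' = ↘-universal (⊑-trans (⊙-monoˡ ψ'⊑ψ) (⊑-trans ↘-counit ξ⊑ξ'))

  ↙-compose : {ξ : Rel X Z} {ψ : Rel X W} {φ : Rel X Y} → ξ ↙ ψ ⊙ ψ ↙ φ ⊑ ξ ↙ φ
  ↙-compose = ↙-universal (⊑-trans ⊙-assocˡ (⊑-trans (⊙-monoʳ ↙-counit) ↙-counit))

  ↘-compose : {φ : Rel Y Z} {ψ : Rel W Z} {ξ : Rel X Z} → φ ↘ ψ ⊙ ψ ↘ ξ ⊑ φ ↘ ξ
  ↘-compose = ↘-universal (⊑-trans ⊙-assocʳ (⊑-trans (⊙-monoˡ ↘-counit) ↘-counit))

  ↙-closedˡ : {ξ : Rel X Z} {φ : Rel X Y} {χ : Rel Z Z} → χ ⊙ ξ ⊑ ξ → χ ⊙ ξ ↙ φ ⊑ ξ ↙ φ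
  ↙-closedˡ χξ⊑ξ = ↙-universal (⊑-trans ⊙-assocˡ (⊑-trans (⊙-monoʳ ↙-counit) χξ⊑ξ))

  ↙-closedʳ : {ξ : Rel X Z} {φ : Rel X Y} {χ : Rel Y Y} → χ ⊙ φ ⊑ φ → ξ ↙ φ ⊙ χ ⊑ ξ ↙ φ
  ↙-closedʳ χφ⊑φ = ↙-universal (⊑-trans ⊙-assocˡ (⊑-trans (⊙-monoʳ χφ⊑φ) ↙-counit))

  ↘-closedˡ : {ψ : Rel Y Z} {ξ : Rel X Z} {χ : Rel Y Y} → ψ ⊙ χ ⊑ ψ → χ ⊙ ψ ↘ ξ ⊑ ψ ↘ ξ
  ↘-closedˡ ψχ⊑ψ = ↘-universal (⊑-trans ⊙-assocʳ (⊑-trans (⊙-monoˡ ψχ⊑ψ) ↘-counit))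

  ↘-closedʳ : {ψ : Rel Y Z} {ξ : Rel X Z} {χ : Rel X X} → ξ ⊙ χ ⊑ ξ → ψ ↘ ξ ⊙ χ ⊑ ψ ↘ ξ
  ↘-closedʳ ξχ⊑ξ = ↘-universal (⊑-trans ⊙-assocʳ (⊑-trans (⊙-monoˡ ↘-counit) ξχ⊑ξ))

  scalar : (q : Carrier) → Rel (one 𝔔 q) (one 𝔔 q)
  ⌞ scalar q ⌟ = record { rel = λ _ _ → q ; inD = λ _ _ → hasRightFactor-refl , hasLeftFactor-refl }

  column : Rel X Y → (y : Elt Y) → Rel X (one 𝔔 (∣ Y ∣ y))
  ⌞ column φ y ⌟ = record { rel = λ x _ → φ ⟨ x , y ⟩ ; inD = λ x _ → inD ⌞ φ ⌟ x y }

  row : Rel X Y → (x : Elt X) → Rel (one 𝔔 (∣ X ∣ x)) Y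
  ⌞ row φ x ⌟ = record { rel = λ _ y → φ ⟨ x , y ⟩ ; inD = λ _ y → inD ⌞ φ ⌟ x y }

  entry : Rel X Y → (x : Elt X) (y : Elt Y) → Rel (one 𝔔 (∣ X ∣ x)) (one 𝔔 (∣ Y ∣ y))
  ⌞ entry φ x y ⌟ = record { rel = λ _ _ → φ ⟨ x , y ⟩ ; inD = λ _ _ → inD ⌞ φ ⌟ x y }

  ⊙-summand : (ψ : Rel Y Z) (φ : Rel X Y) → ∀ x y z → (ψ ⟨ y , z ⟩ / ∣ Y ∣ y) & φ ⟨ x , y ⟩ ≤ (ψ ⊙ φ) ⟨ x , z ⟩
  ⊙-summand ψ φ x y z = ⋁-upper (λ y' → (ψ ⟨ y' , z ⟩ / _) & φ ⟨ x , y' ⟩) y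

  row-⊙-column : (ψ : Rel Y Z) (φ : Rel X Y) (y : Elt Y) → row ψ y ⊙ column φ y ⊑ ψ ⊙ φ
  row-⊙-column ψ φ y = pointwise λ x z → ≤-trans (≤-reflexive (⋁-⊤ _)) (⊙-summand ψ φ x y z)

  entry-⊙-column : (ψ : Rel Y Z) (φ : Rel X Y) (y : Elt Y) (z : Elt Z) → entry ψ y z ⊙ column φ y ⊑ column (ψ ⊙ φ) z
  entry-⊙-column ψ φ y z = pointwise λ x _ → ≤-trans (≤-reflexive (⋁-⊤ _)) (⊙-summand ψ φ x y z)

  row-⊙-entry : (ψ : Rel Y Z) (φ : Rel X Y) (x : Elt X) (y : Elt Y) → row ψ y ⊙ entry φ x y ⊑ row (ψ ⊙ φ) x
  row-⊙-entry ψ φ x y = pointwise λ _ z → ≤-trans (≤-reflexive (⋁-⊤ _)) (⊙-summand ψ φ x y z)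

module PreorderedSubsets (𝔔 : Quantale) where
  open Quantale 𝔔
  open QuantaleArithmetic 𝔔
  open RelationCalculus 𝔔

  private variable
    Z : QSubset 𝔔
    X Y : QPreordered 𝔔

  carrier : QPreordered 𝔔 → QSubset 𝔔
  carrier X = sub (pre X)

  Hom : (X : QPreordered 𝔔) → Rel (carrier X) (carrier X)
  ⌞ Hom X ⌟ = record { rel = hom (pre X) ; inD = homRel X }

  Hom-refl : (X : QPreordered 𝔔) (x : Elt (carrier X)) → ∣ carrier X ∣ x ≤ Hom X ⟨ x , x ⟩
  Hom-refl X x = ≤-trans (⋁-upper {I = x ≡ x} _ refl) (homRefl X x x)

  Hom-⊙-Hom : Hom X ⊙ Hom X ⊑ Hom X
  Hom-⊙-Hom {X = X} = pointwise (homTran X)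

  ⊑-⊙-Hom : {φ : Rel (carrier X) Z} → φ ⊑ φ ⊙ Hom X
  ⊑-⊙-Hom {X = X} {φ = φ} = pointwise λ x z →
    ≤-trans (≤-/-& (rightFactor φ x z) (Hom-refl X x)) (⊙-summand φ (Hom X) x x z)

  ⊑-Hom-⊙ : {φ : Rel Z (carrier Y)} → φ ⊑ Hom Y ⊙ φ
  ⊑-Hom-⊙ {Y = Y} {φ = φ} = pointwise λ x y → begin
    φ ⟨ x , y ⟩                                        ≡⟨ sym (/-self-& (leftFactor φ x y)) ⟩
    (∣ carrier Y ∣ y / ∣ carrier Y ∣ y) & φ ⟨ x , y ⟩  ≤⟨ &-monoˡ _ (/-mono (Hom-refl Y y)) ⟩
    (Hom Y ⟨ y , y ⟩ / ∣ carrier Y ∣ y) & φ ⟨ x , y ⟩  ≤⟨ ⊙-summand (Hom Y) φ x y y ⟩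
    (Hom Y ⊙ φ) ⟨ x , y ⟩                              ∎
    where open ≤-Reasoning

  ⟦_⟧ : Distributor 𝔔 X Y → Rel (carrier X) (carrier Y)
  ⌞ ⟦ d ⟧ ⌟ = qrel d

  module _ (d : Distributor 𝔔 X Y) where

    Hom-⊙-⊙-Hom-absorb : (Hom Y ⊙ ⟦ d ⟧) ⊙ Hom X ⊑ ⟦ d ⟧
    Hom-⊙-⊙-Hom-absorb = pointwise (dist d)

    Hom-⊙-absorb : Hom Y ⊙ ⟦ d ⟧ ⊑ ⟦ d ⟧
    Hom-⊙-absorb = ⊑-trans ⊑-⊙-Hom Hom-⊙-⊙-Hom-absorb

    ⊙-Hom-absorb : ⟦ d ⟧ ⊙ Hom X ⊑ ⟦ d ⟧
    ⊙-Hom-absorb = ⊑-trans (⊙-monoˡ ⊑-Hom-⊙) Hom-⊙-⊙-Hom-absorb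

    Hom-⊙-identity : ∀ x y → (Hom Y ⊙ ⟦ d ⟧) ⟨ x , y ⟩ ≡ ⟦ d ⟧ ⟨ x , y ⟩
    Hom-⊙-identity x y = antisym (⊑⇒≤ Hom-⊙-absorb x y) (⊑⇒≤ (⊑-Hom-⊙ {Y = Y} {φ = ⟦ d ⟧}) x y)

    ⊙-Hom-identity : ∀ x y → (⟦ d ⟧ ⊙ Hom X) ⟨ x , y ⟩ ≡ ⟦ d ⟧ ⟨ x , y ⟩
    ⊙-Hom-identity x y = antisym (⊑⇒≤ ⊙-Hom-absorb x y) (⊑⇒≤ (⊑-⊙-Hom {X = X} {φ = ⟦ d ⟧}) x y)

  mkDistributor : (φ : Rel (carrier X) (carrier Y)) → Hom Y ⊙ φ ⊑ φ → φ ⊙ Hom X ⊑ φ → Distributor 𝔔 X Y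
  mkDistributor φ Hφ⊑φ φH⊑φ = record
    { qrel = ⌞ φ ⌟ ; dist = ⊑⇒≤ (⊑-trans (⊙-monoˡ Hφ⊑φ) φH⊑φ) }

  Hom-distributor : (X : QPreordered 𝔔) → Distributor 𝔔 X X
  Hom-distributor X = mkDistributor (Hom X) Hom-⊙-Hom Hom-⊙-Hom

module GaloisConnections (𝔔 : Quantale) where
  open Quantale 𝔔
  open QuantaleArithmetic 𝔔

  _∘ₘ_ : {A B C : QPre 𝔔} → OPMap 𝔔 B C → OPMap 𝔔 A B → OPMap 𝔔 A C
  g ∘ₘ f = record
    { fun  = λ a → fun g (fun f a)
    ; pres = λ a → trans (pres g (fun f a)) (pres f a)
    ; mono = λ a a' → ≤-trans (mono f a a') (mono g (fun f a) (fun f a')) }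

  record HomRespectsBelow (A : QPre 𝔔) : Set where
    field
      hom-monoʳ : ∀ {a b c} → Below 𝔔 A b c → hom A a b ≤ hom A a c
      hom-antiˡ : ∀ {a b c} → Below 𝔔 A a b → hom A b c ≤ hom A a c

  module _ {A B : QPre 𝔔} (respA : HomRespectsBelow A) (respB : HomRespectsBelow B) where
    open HomRespectsBelow

    adjoint-≤ : (G : Galois 𝔔 A B) → ∀ a b → hom A a (fun (right G) b) ≤ hom B (fun (left G) a) b
    adjoint-≤ G a b = ≤-trans (mono (left G) a _) (hom-monoʳ respB (counit G b))

    adjoint-≥ : (G : Galois 𝔔 A B) → ∀ a b → hom B (fun (left G) a) b ≤ hom A a (fun (right G) b)
    adjoint-≥ G a b = ≤-trans (mono (right G) _ b) (hom-antiˡ respA (unit G a))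

    right-adjoint-below : (G G' : Galois 𝔔 A B) →
      (∀ a → Below 𝔔 B (fun (left G') a) (fun (left G) a)) →
      ∀ b → Below 𝔔 A (fun (right G) b) (fun (right G') b)
    right-adjoint-below G G' f'≤f b = trans (pres (right G) b) (sym (pres (right G') b)) , (begin
      ∣ sub A ∣ (g b)                 ≡⟨ sym (pres (left G) (g b)) ⟩
      ∣ sub B ∣ (fun (left G) (g b))  ≤⟨ proj₂ (counit G b) ⟩
      hom B (fun (left G) (g b)) b    ≤⟨ hom-antiˡ respB (f'≤f (g b)) ⟩
      hom B (fun (left G') (g b)) b   ≤⟨ adjoint-≥ G' (g b) b ⟩
      hom A (g b) (fun (right G') b)  ∎)
      where
      open ≤-Reasoning
      g = fun (right G)

    left-adjoint-below : (G G' : Galois 𝔔 A B) →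
      (∀ b → Below 𝔔 A (fun (right G') b) (fun (right G) b)) →
      ∀ a → Below 𝔔 B (fun (left G) a) (fun (left G') a)
    left-adjoint-below G G' g'≤g a = trans (pres (left G) a) (sym (pres (left G') a)) , (begin
      ∣ sub B ∣ (fun (left G) a)        ≡⟨ pres (left G) a ⟩
      ∣ sub A ∣ a                       ≤⟨ proj₂ (unit G' a) ⟩
      hom A a (fun (right G') (f' a))   ≤⟨ hom-monoʳ respA (g'≤g (f' a)) ⟩
      hom A a (fun (right G) (f' a))    ≤⟨ adjoint-≤ G a (f' a) ⟩
      hom B (fun (left G) a) (f' a)     ∎)
      where
      open ≤-Reasoning
      f' = fun (left G')

    module _ {_≈A_ : Elt (sub A) → Elt (sub A) → Set} {_≈B_ : Elt (sub B) → Elt (sub B) → Set}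
             (antisymA : ∀ {a a'} → Below 𝔔 A a a' → Below 𝔔 A a' a → a ≈A a')
             (antisymB : ∀ {b b'} → Below 𝔔 B b b' → Below 𝔔 B b' b → b ≈B b')
             (G G' : Galois 𝔔 A B) where

      ≈-from-right-adjoints :
        (∀ b → Below 𝔔 A (fun (right G) b) (fun (right G') b)) →
        (∀ b → Below 𝔔 A (fun (right G') b) (fun (right G) b)) →
        (∀ a → fun (left G) a ≈B fun (left G') a) × (∀ b → fun (right G) b ≈A fun (right G') b)
      ≈-from-right-adjoints g≤g' g'≤g =
          (λ a → antisymB (left-adjoint-below G G' g'≤g a) (left-adjoint-below G' G g≤g' a))
        , (λ b → antisymA (g≤g' b) (g'≤g b))

      ≈-from-left-adjoints :
        (∀ a → Below 𝔔 B (fun (left G) a) (fun (left G') a)) →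
        (∀ a → Below 𝔔 B (fun (left G') a) (fun (left G) a)) →
        (∀ a → fun (left G) a ≈B fun (left G') a) × (∀ b → fun (right G) b ≈A fun (right G') b)
      ≈-from-left-adjoints f≤f' f'≤f =
          (λ a → antisymB (f≤f' a) (f'≤f a))
        , (λ b → antisymA (right-adjoint-below G G' f'≤f b) (right-adjoint-below G' G f≤f' b))

module Presheaves (𝔔 : Quantale) (X : QPreordered 𝔔) where
  open Quantale 𝔔
  open QuantaleArithmetic 𝔔
  open RelationCalculus 𝔔
  open PreorderedSubsets 𝔔
  open GaloisConnections 𝔔 using (HomRespectsBelow)

  infixl 30 _⦅_⦆ _⦅_⦆†

  private
    S = carrier X

  presheaf : (μ : PElt 𝔔 X) → Rel S (one 𝔔 (proj₁ μ))
  ⌞ presheaf μ ⌟ = proj₁ (proj₂ μ)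

  copresheaf : (κ : P†Elt 𝔔 X) → Rel (one 𝔔 (proj₁ κ)) S
  ⌞ copresheaf κ ⌟ = proj₁ (proj₂ κ)

  _⦅_⦆ : PElt 𝔔 X → Elt S → Carrier
  μ ⦅ x ⦆ = presheaf μ ⟨ x , tt ⟩

  _⦅_⦆† : P†Elt 𝔔 X → Elt S → Carrier
  κ ⦅ x ⦆† = copresheaf κ ⟨ tt , x ⟩

  presheaf-closed : (μ : PElt 𝔔 X) → presheaf μ ⊙ Hom X ⊑ presheaf μ
  presheaf-closed μ = pointwise (proj₂ (proj₂ μ))

  copresheaf-closed : (κ : P†Elt 𝔔 X) → Hom X ⊙ copresheaf κ ⊑ copresheaf κ
  copresheaf-closed κ = pointwise (proj₂ (proj₂ κ))

  mkPresheaf : ∀ {q} (μ : Rel S (one 𝔔 q)) → μ ⊙ Hom X ⊑ μ → PElt 𝔔 X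
  mkPresheaf μ μH⊑μ = _ , ⌞ μ ⌟ , ⊑⇒≤ μH⊑μ

  mkCopresheaf : ∀ {q} (κ : Rel (one 𝔔 q) S) → Hom X ⊙ κ ⊑ κ → P†Elt 𝔔 X
  mkCopresheaf κ Hκ⊑κ = _ , ⌞ κ ⌟ , ⊑⇒≤ Hκ⊑κ

  module _ {μ ν : PElt 𝔔 X} where

    𝖯-hom-universal : (ψ : Rel (one 𝔔 (proj₁ μ)) (one 𝔔 (proj₁ ν))) →
                      ψ ⊙ presheaf μ ⊑ presheaf ν → ψ ⟨ tt , tt ⟩ ≤ hom (𝖯 𝔔 X) μ ν
    𝖯-hom-universal ψ ψμ⊑ν = ⊑⇒≤ (↙-universal ψμ⊑ν) tt tt

    𝖯-hom-counit : ∀ x → (hom (𝖯 𝔔 X) μ ν / proj₁ μ) & μ ⦅ x ⦆ ≤ ν ⦅ x ⦆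
    𝖯-hom-counit x = ≤-trans (⊙-summand (presheaf ν ↙ presheaf μ) (presheaf μ) x tt tt)
                             (⊑⇒≤ (↙-counit {ξ = presheaf ν} {φ = presheaf μ}) x tt)

    𝖯-below⇒≤ : Below 𝔔 (𝖯 𝔔 X) μ ν → ∀ x → μ ⦅ x ⦆ ≤ ν ⦅ x ⦆
    𝖯-below⇒≤ (_ , q≤hom) x = begin
      μ ⦅ x ⦆                                   ≡⟨ sym (/-self-& (leftFactor (presheaf μ) x tt)) ⟩
      (proj₁ μ / proj₁ μ) & μ ⦅ x ⦆             ≤⟨ &-monoˡ _ (/-mono q≤hom) ⟩
      (hom (𝖯 𝔔 X) μ ν / proj₁ μ) & μ ⦅ x ⦆     ≤⟨ 𝖯-hom-counit x ⟩
      ν ⦅ x ⦆                                   ∎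
      where open ≤-Reasoning

  ≤⇒𝖯-below : {μ ν : PElt 𝔔 X} → proj₁ μ ≡ proj₁ ν → (∀ x → μ ⦅ x ⦆ ≤ ν ⦅ x ⦆) → Below 𝔔 (𝖯 𝔔 X) μ ν
  ≤⇒𝖯-below {μ} {ν} refl μ≤ν = refl , 𝖯-hom-universal {μ} {ν} (scalar (proj₁ μ)) (pointwise λ x _ →
    ≤-trans (≤-reflexive (trans (⋁-⊤ _) (/-self-& (leftFactor (presheaf μ) x tt)))) (μ≤ν x))

  𝖯-antisym : {μ ν : PElt 𝔔 X} → Below 𝔔 (𝖯 𝔔 X) μ ν → Below 𝔔 (𝖯 𝔔 X) ν μ → EqP 𝔔 X μ ν
  𝖯-antisym {μ} {ν} μ≤ν ν≤μ =
    proj₁ μ≤ν , λ x → antisym (𝖯-below⇒≤ {μ} {ν} μ≤ν x) (𝖯-below⇒≤ {ν} {μ} ν≤μ x)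

  ≈⇒𝖯-below : {μ ν : PElt 𝔔 X} → EqP 𝔔 X μ ν → Below 𝔔 (𝖯 𝔔 X) μ ν
  ≈⇒𝖯-below {μ} {ν} (q≡q' , μ≡ν) = ≤⇒𝖯-below {μ} {ν} q≡q' (λ x → ≤-reflexive (μ≡ν x))

  ≈⇒𝖯-above : {μ ν : PElt 𝔔 X} → EqP 𝔔 X μ ν → Below 𝔔 (𝖯 𝔔 X) ν μ
  ≈⇒𝖯-above {μ} {ν} (q≡q' , μ≡ν) = ≤⇒𝖯-below {ν} {μ} (sym q≡q') (λ x → ≤-reflexive (sym (μ≡ν x)))

  module _ {κ κ' : P†Elt 𝔔 X} where

    𝖯†-hom-universal : (ψ : Rel (one 𝔔 (proj₁ κ)) (one 𝔔 (proj₁ κ'))) →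
                       copresheaf κ' ⊙ ψ ⊑ copresheaf κ → ψ ⟨ tt , tt ⟩ ≤ hom (𝖯† 𝔔 X) κ κ'
    𝖯†-hom-universal ψ κ'ψ⊑κ = ⊑⇒≤ (↘-universal κ'ψ⊑κ) tt tt

    𝖯†-hom-counit : ∀ x → (κ' ⦅ x ⦆† / proj₁ κ') & hom (𝖯† 𝔔 X) κ κ' ≤ κ ⦅ x ⦆†
    𝖯†-hom-counit x = ≤-trans (⊙-summand (copresheaf κ') (copresheaf κ' ↘ copresheaf κ) tt tt x)
                              (⊑⇒≤ (↘-counit {ψ = copresheaf κ'} {ξ = copresheaf κ}) tt x)

  𝖯†-below⇒≥ : {κ κ' : P†Elt 𝔔 X} → Below 𝔔 (𝖯† 𝔔 X) κ κ' → ∀ x → κ' ⦅ x ⦆† ≤ κ ⦅ x ⦆†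
  𝖯†-below⇒≥ {κ} {κ'} (refl , q≤hom) x =
    ≤-trans (≤-/-& (rightFactor (copresheaf κ') tt x) q≤hom) (𝖯†-hom-counit {κ} {κ'} x)

  ≥⇒𝖯†-below : {κ κ' : P†Elt 𝔔 X} → proj₁ κ ≡ proj₁ κ' → (∀ x → κ' ⦅ x ⦆† ≤ κ ⦅ x ⦆†) → Below 𝔔 (𝖯† 𝔔 X) κ κ'
  ≥⇒𝖯†-below {κ} {κ'} refl κ'≤κ = refl , 𝖯†-hom-universal {κ} {κ'} (scalar (proj₁ κ)) (pointwise λ _ x →
    ≤-trans (≤-reflexive (trans (⋁-⊤ _) (rightFactor (copresheaf κ') tt x))) (κ'≤κ x))

  ≈⇒𝖯†-below : {κ κ' : P†Elt 𝔔 X} → EqP† 𝔔 X κ κ' → Below 𝔔 (𝖯† 𝔔 X) κ κ'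
  ≈⇒𝖯†-below {κ} {κ'} (q≡q' , κ≡κ') = ≥⇒𝖯†-below {κ} {κ'} q≡q' (λ x → ≤-reflexive (sym (κ≡κ' x)))

  ≈⇒𝖯†-above : {κ κ' : P†Elt 𝔔 X} → EqP† 𝔔 X κ κ' → Below 𝔔 (𝖯† 𝔔 X) κ' κ
  ≈⇒𝖯†-above {κ} {κ'} (q≡q' , κ≡κ') = ≥⇒𝖯†-below {κ'} {κ} (sym q≡q') (λ x → ≤-reflexive (κ≡κ' x))

  𝖯†-antisym : {κ κ' : P†Elt 𝔔 X} → Below 𝔔 (𝖯† 𝔔 X) κ κ' → Below 𝔔 (𝖯† 𝔔 X) κ' κ → EqP† 𝔔 X κ κ'
  𝖯†-antisym {κ} {κ'} κ≤κ' κ'≤κ =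
    proj₁ κ≤κ' , λ x → antisym (𝖯†-below⇒≥ {κ'} {κ} κ'≤κ x) (𝖯†-below⇒≥ {κ} {κ'} κ≤κ' x)

  𝖯-respects-below : HomRespectsBelow (𝖯 𝔔 X)
  𝖯-respects-below = record
    { hom-monoʳ = λ { {μ} {ν} {ν'} ν≤ν'@(refl , _) → ⊑⇒≤
        (↙-mono {ξ = presheaf ν} {presheaf ν'} {presheaf μ}
                (pointwise λ x _ → 𝖯-below⇒≤ {ν} {ν'} ν≤ν' x) ⊑-refl) tt tt }
    ; hom-antiˡ = λ { {μ} {μ'} {ν} μ≤μ'@(refl , _) → ⊑⇒≤
        (↙-mono {ξ = presheaf ν} {presheaf ν} {presheaf μ'} {presheaf μ}
                ⊑-refl (pointwise λ x _ → 𝖯-below⇒≤ {μ} {μ'} μ≤μ' x)) tt tt }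
    }

  𝖯†-respects-below : HomRespectsBelow (𝖯† 𝔔 X)
  𝖯†-respects-below = record
    { hom-monoʳ = λ { {κ} {κ₁} {κ₂} κ₁≤κ₂@(refl , _) → ⊑⇒≤
        (↘-mono {ψ = copresheaf κ₁} {copresheaf κ₂} {copresheaf κ}
                (pointwise λ _ x → 𝖯†-below⇒≥ {κ₁} {κ₂} κ₁≤κ₂ x) ⊑-refl) tt tt }
    ; hom-antiˡ = λ { {κ₁} {κ₂} {κ} κ₁≤κ₂@(refl , _) → ⊑⇒≤
        (↘-mono {ψ = copresheaf κ} {copresheaf κ} {copresheaf κ₂} {copresheaf κ₁}
                ⊑-refl (pointwise λ _ x → 𝖯†-below⇒≥ {κ₁} {κ₂} κ₁≤κ₂ x)) tt tt }
    }

module DistributorsAsMaps (𝔔 : Quantale) (X Y : QPreordered 𝔔) where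
  open Quantale 𝔔
  open QuantaleArithmetic 𝔔
  open RelationCalculus 𝔔
  open PreorderedSubsets 𝔔
  module PX = Presheaves 𝔔 X
  module PY = Presheaves 𝔔 Y
  open PX using (_⦅_⦆)
  open PY using (_⦅_⦆†)

  private
    SX = carrier X
    SY = carrier Y

  columns : Distributor 𝔔 X Y → OPMap 𝔔 (pre Y) (𝖯 𝔔 X)
  columns d = record
    { fun  = λ y → PX.mkPresheaf (column ⟦ d ⟧ y) (pointwise λ x _ → ⊑⇒≤ (⊙-Hom-absorb d) x y)
    ; pres = λ _ → refl
    ; mono = λ y y' → ⊑⇒≤ (↙-universal {ξ = column ⟦ d ⟧ y'} {φ = column ⟦ d ⟧ y} {ψ = entry (Hom Y) y y'}
               (⊑-trans (entry-⊙-column (Hom Y) ⟦ d ⟧ y y') (pointwise λ x _ → ⊑⇒≤ (Hom-⊙-absorb d) x y'))) tt tt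
    }

  rows : Distributor 𝔔 X Y → OPMap 𝔔 (pre X) (𝖯† 𝔔 Y)
  rows d = record
    { fun  = λ x → PY.mkCopresheaf (row ⟦ d ⟧ x) (pointwise λ _ y → ⊑⇒≤ (Hom-⊙-absorb d) x y)
    ; pres = λ _ → refl
    ; mono = λ x x' → ⊑⇒≤ (↘-universal {ψ = row ⟦ d ⟧ x'} {ξ = row ⟦ d ⟧ x} {φ = entry (Hom X) x x'}
               (⊑-trans (row-⊙-entry ⟦ d ⟧ (Hom X) x x') (pointwise λ _ y → ⊑⇒≤ (⊙-Hom-absorb d) x y))) tt tt
    }

  module _ (f : OPMap 𝔔 (pre Y) (𝖯 𝔔 X)) where

    tabulate-columns : Rel SX SY
    ⌞ tabulate-columns ⌟ = record
      { rel = λ x y → fun f y ⦅ x ⦆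
      ; inD = λ x y → subst (λ q → InD (∣ SX ∣ x) q (fun f y ⦅ x ⦆)) (pres f y) (inD ⌞ PX.presheaf (fun f y) ⌟ x tt) }

    from-columns : Distributor 𝔔 X Y
    from-columns = mkDistributor tabulate-columns
      (pointwise λ x y → ⋁-least _ _ λ y' → ≤-trans (&-monoˡ _ (/-mono (mono f y' y)))
        (subst (λ r → (hom (𝖯 𝔔 X) (fun f y') (fun f y) / r) & fun f y' ⦅ x ⦆ ≤ fun f y ⦅ x ⦆)
               (pres f y') (PX.𝖯-hom-counit {fun f y'} {fun f y} x)))
      (pointwise λ x y → ⊑⇒≤ (PX.presheaf-closed (fun f y)) x tt)

  module _ (f : OPMap 𝔔 (pre X) (𝖯† 𝔔 Y)) where

    tabulate-rows : Rel SX SY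
    ⌞ tabulate-rows ⌟ = record
      { rel = λ x y → fun f x ⦅ y ⦆†
      ; inD = λ x y → subst (λ q → InD q (∣ SY ∣ y) (fun f x ⦅ y ⦆†)) (pres f x) (inD ⌞ PY.copresheaf (fun f x) ⌟ tt y) }

    from-rows : Distributor 𝔔 X Y
    from-rows = mkDistributor tabulate-rows
      (pointwise λ x y → ⊑⇒≤ (PY.copresheaf-closed (fun f x)) tt y)
      (pointwise λ x y → ⋁-least _ _ λ x' → ≤-trans (&-monoʳ _ (mono f x x'))
        (subst (λ r → (fun f x' ⦅ y ⦆† / r) & hom (𝖯† 𝔔 Y) (fun f x) (fun f x') ≤ fun f x ⦅ y ⦆†)
               (pres f x') (PY.𝖯†-hom-counit {fun f x} {fun f x'} y)))

  distributors↔columns : Inverse (DistSetoid 𝔔 X Y) (MapsToP 𝔔 X Y)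
  distributors↔columns = record
    { to = columns ; from = from-columns
    ; to-cong = λ d≈d' y → refl , λ x → d≈d' x y
    ; from-cong = λ f≈f' x y → proj₂ (f≈f' y) x
    ; inverse = (λ {f} d≈ y → sym (pres f y) , λ x → d≈ x y) , (λ f≈ x y → proj₂ (f≈ y) x)
    }

  distributors↔rows : Inverse (DistSetoid 𝔔 X Y) (MapsToP† 𝔔 X Y)
  distributors↔rows = record
    { to = rows ; from = from-rows
    ; to-cong = λ d≈d' x → refl , λ y → d≈d' x y
    ; from-cong = λ f≈f' x y → proj₂ (f≈f' x) y
    ; inverse = (λ {f} d≈ x → sym (pres f x) , λ y → d≈ x y) , (λ f≈ x y → proj₂ (f≈ x) y)
    }

module Yoneda (𝔔 : Quantale) (X : QPreordered 𝔔) where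
  open Quantale 𝔔
  open QuantaleArithmetic 𝔔
  open RelationCalculus 𝔔
  open PreorderedSubsets 𝔔
  open Presheaves 𝔔 X
  open DistributorsAsMaps 𝔔 X X using (columns; rows)
  open GaloisConnections 𝔔

  private
    S = carrier X
    H = Hom X

  yoneda : OPMap 𝔔 (pre X) (𝖯 𝔔 X)
  yoneda = columns (Hom-distributor X)

  yoneda† : OPMap 𝔔 (pre X) (𝖯† 𝔔 X)
  yoneda† = rows (Hom-distributor X)

  ↙-representable : ∀ {Z} (ξ : Rel S Z) → ξ ⊙ H ⊑ ξ → ∀ x z → (ξ ↙ column H x) ⟨ tt , z ⟩ ≡ ξ ⟨ x , z ⟩
  ↙-representable ξ ξH⊑ξ x z = antisym
    (begin
      L ⟨ tt , z ⟩                            ≤⟨ ≤-/-& (rightFactor L tt z) (Hom-refl X x) ⟩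
      (L ⟨ tt , z ⟩ / ∣ S ∣ x) & H ⟨ x , x ⟩  ≤⟨ ⊙-summand L (column H x) x tt z ⟩
      (L ⊙ column H x) ⟨ x , z ⟩              ≤⟨ ⊑⇒≤ (↙-counit {ξ = ξ} {φ = column H x}) x z ⟩
      ξ ⟨ x , z ⟩                             ∎)
    (⊑⇒≤ (↙-universal {ψ = row ξ x} (⊑-trans (row-⊙-column ξ H x) ξH⊑ξ)) tt z)
    where
    open ≤-Reasoning
    L = ξ ↙ column H x

  ↘-representable : ∀ {W} (ξ : Rel W S) → H ⊙ ξ ⊑ ξ → ∀ x w → (row H x ↘ ξ) ⟨ w , tt ⟩ ≡ ξ ⟨ w , x ⟩
  ↘-representable ξ Hξ⊑ξ x w = antisym
    (begin
      E ⟨ w , tt ⟩                            ≡⟨ sym (/-self-& (leftFactor E w tt)) ⟩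
      (∣ S ∣ x / ∣ S ∣ x) & E ⟨ w , tt ⟩      ≤⟨ &-monoˡ _ (/-mono (Hom-refl X x)) ⟩
      (H ⟨ x , x ⟩ / ∣ S ∣ x) & E ⟨ w , tt ⟩  ≤⟨ ⊙-summand (row H x) E w tt x ⟩
      (row H x ⊙ E) ⟨ w , x ⟩                ≤⟨ ⊑⇒≤ (↘-counit {ψ = row H x} {ξ = ξ}) w x ⟩
      ξ ⟨ w , x ⟩                            ∎)
    (⊑⇒≤ (↘-universal {φ = column ξ x} (⊑-trans (row-⊙-column H ξ x) Hξ⊑ξ)) w tt)
    where
    open ≤-Reasoning
    E = row H x ↘ ξ

  yoneda-lemma : ∀ μ x → hom (𝖯 𝔔 X) (fun yoneda x) μ ≡ μ ⦅ x ⦆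
  yoneda-lemma μ x = ↙-representable (presheaf μ) (presheaf-closed μ) x tt

  yoneda†-lemma : ∀ κ x → hom (𝖯† 𝔔 X) κ (fun yoneda† x) ≡ κ ⦅ x ⦆†
  yoneda†-lemma κ x = ↘-representable (copresheaf κ) (copresheaf-closed κ) x tt

  module _ {B : QPre 𝔔} (respB : HomRespectsBelow B) (G G' : Galois 𝔔 (𝖯 𝔔 X) B) where

    right-adjoint-below-via-yoneda :
      (∀ x → Below 𝔔 B (fun (left G') (fun yoneda x)) (fun (left G) (fun yoneda x))) →
      ∀ b → Below 𝔔 (𝖯 𝔔 X) (fun (right G) b) (fun (right G') b)
    right-adjoint-below-via-yoneda f'≤f b =
      ≤⇒𝖯-below {fun (right G) b} {fun (right G') b} (trans (pres (right G) b) (sym (pres (right G') b))) λ x → begin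
        g b ⦅ x ⦆                          ≡⟨ sym (yoneda-lemma (g b) x) ⟩
        hom (𝖯 𝔔 X) (yo x) (g b)           ≤⟨ adjoint-≤ 𝖯-respects-below respB G (yo x) b ⟩
        hom B (fun (left G) (yo x)) b      ≤⟨ HomRespectsBelow.hom-antiˡ respB (f'≤f x) ⟩
        hom B (fun (left G') (yo x)) b     ≤⟨ adjoint-≥ 𝖯-respects-below respB G' (yo x) b ⟩
        hom (𝖯 𝔔 X) (yo x) (g' b)          ≡⟨ yoneda-lemma (g' b) x ⟩
        g' b ⦅ x ⦆                         ∎
      where
      open ≤-Reasoning
      yo = fun yoneda
      g  = fun (right G)
      g' = fun (right G')

  module _ {A : QPre 𝔔} (respA : HomRespectsBelow A) (G G' : Galois 𝔔 A (𝖯† 𝔔 X)) where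

    left-adjoint-below-via-yoneda† :
      (∀ x → Below 𝔔 A (fun (right G') (fun yoneda† x)) (fun (right G) (fun yoneda† x))) →
      ∀ a → Below 𝔔 (𝖯† 𝔔 X) (fun (left G) a) (fun (left G') a)
    left-adjoint-below-via-yoneda† g'≤g a =
      ≥⇒𝖯†-below {fun (left G) a} {fun (left G') a} (trans (pres (left G) a) (sym (pres (left G') a))) λ x → begin
        f' a ⦅ x ⦆†                          ≡⟨ sym (yoneda†-lemma (f' a) x) ⟩
        hom (𝖯† 𝔔 X) (f' a) (yo† x)          ≤⟨ adjoint-≥ respA 𝖯†-respects-below G' a (yo† x) ⟩
        hom A a (fun (right G') (yo† x))     ≤⟨ HomRespectsBelow.hom-monoʳ respA (g'≤g x) ⟩
        hom A a (fun (right G) (yo† x))      ≤⟨ adjoint-≤ respA 𝖯†-respects-below G a (yo† x) ⟩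
        hom (𝖯† 𝔔 X) (f a) (yo† x)           ≡⟨ yoneda†-lemma (f a) x ⟩
        f a ⦅ x ⦆†                           ∎
      where
      open ≤-Reasoning
      yo† = fun yoneda†
      f   = fun (left G)
      f'  = fun (left G')

module DistributorsAsPolarities (𝔔 : Quantale) (X Y : QPreordered 𝔔) where
  open RelationCalculus 𝔔
  open PreorderedSubsets 𝔔
  open GaloisConnections 𝔔
  module PX = Presheaves 𝔔 X
  module PY = Presheaves 𝔔 Y
  open PX using (presheaf)
  open PY using (copresheaf)
  open Yoneda 𝔔 X using (yoneda; ↙-representable; right-adjoint-below-via-yoneda)
  open DistributorsAsMaps 𝔔 X Y using (from-rows)
  open Setoid (Polarities 𝔔 X Y) using () renaming (_≈_ to _≈ᴳ_)

  polarity : Distributor 𝔔 X Y → Galois 𝔔 (𝖯 𝔔 X) (𝖯† 𝔔 Y)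
  polarity d = record
    { left = record
        { fun = F ; pres = λ _ → refl
        ; mono = λ μ ν → ⊑⇒≤ (↘-universal {ψ = φ ↙ presheaf ν} {ξ = φ ↙ presheaf μ}
                                {φ = presheaf ν ↙ presheaf μ} ↙-compose) tt tt }
    ; right = record
        { fun = G ; pres = λ _ → refl
        ; mono = λ κ κ' → ⊑⇒≤ (↙-universal {ξ = copresheaf κ' ↘ φ} {φ = copresheaf κ ↘ φ}
                                 {ψ = copresheaf κ' ↘ copresheaf κ} ↘-compose) tt tt }
    ; unit = λ μ → PX.≤⇒𝖯-below {μ} {G (F μ)} refl λ x →
        ⊑⇒≤ (↘-universal {ψ = φ ↙ presheaf μ} {ξ = φ} {φ = presheaf μ} ↙-counit) x tt
    ; counit = λ κ → PY.≥⇒𝖯†-below {F (G κ)} {κ} refl λ y →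
        ⊑⇒≤ (↙-universal {ξ = φ} {φ = copresheaf κ ↘ φ} {ψ = copresheaf κ} ↘-counit) tt y
    }
    where
    φ = ⟦ d ⟧
    F : PElt 𝔔 X → P†Elt 𝔔 Y
    F μ = PY.mkCopresheaf (φ ↙ presheaf μ) (↙-closedˡ (Hom-⊙-absorb d))
    G : P†Elt 𝔔 Y → PElt 𝔔 X
    G κ = PX.mkPresheaf (copresheaf κ ↘ φ) (↘-closedʳ (⊙-Hom-absorb d))

  polarity⁻¹ : Galois 𝔔 (𝖯 𝔔 X) (𝖯† 𝔔 Y) → Distributor 𝔔 X Y
  polarity⁻¹ G = from-rows (left G ∘ₘ yoneda)

  polarity⁻¹-polarity : ∀ d x y → ⟦ polarity⁻¹ (polarity d) ⟧ ⟨ x , y ⟩ ≡ ⟦ d ⟧ ⟨ x , y ⟩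
  polarity⁻¹-polarity d = ↙-representable ⟦ d ⟧ (⊙-Hom-absorb d)

  polarity-unique : ∀ G d → (∀ x y → ⟦ d ⟧ ⟨ x , y ⟩ ≡ ⟦ polarity⁻¹ G ⟧ ⟨ x , y ⟩) → polarity d ≈ᴳ G
  polarity-unique G d d≈ =
    ≈-from-right-adjoints PX.𝖯-respects-below PY.𝖯†-respects-below
      (λ {μ} {ν} → PX.𝖯-antisym {μ} {ν}) (λ {κ} {κ'} → PY.𝖯†-antisym {κ} {κ'}) (polarity d) G
      (right-adjoint-below-via-yoneda PY.𝖯†-respects-below (polarity d) G λ x →
        PY.≈⇒𝖯†-below {f (yo x)} {f* (yo x)} (agree x))
      (right-adjoint-below-via-yoneda PY.𝖯†-respects-below G (polarity d) λ x →
        PY.≈⇒𝖯†-above {f (yo x)} {f* (yo x)} (agree x))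
    where
    yo = fun yoneda
    f  = fun (left G)
    f* = fun (left (polarity d))
    agree : ∀ x → EqP† 𝔔 Y (f (yo x)) (f* (yo x))
    agree x = pres (left G) (yo x) , λ y → sym (trans (polarity⁻¹-polarity d x y) (d≈ x y))

  distributors↔polarities : Inverse (DistSetoid 𝔔 X Y) (Polarities 𝔔 X Y)
  distributors↔polarities = record
    { to = polarity ; from = polarity⁻¹
    ; to-cong = λ {d} {d'} d≈d' → polarity-unique (polarity d') d λ x y →
        trans (d≈d' x y) (sym (polarity⁻¹-polarity d' x y))
    ; from-cong = λ G≈G' x y → proj₂ (proj₁ G≈G' (fun yoneda x)) y
    ; inverse = (λ {G} {d} → polarity-unique G d)
              , (λ {d} G≈ x y → trans (proj₂ (proj₁ G≈ (fun yoneda x)) y) (polarity⁻¹-polarity d x y))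
    }

module DistributorsAsAxialities (𝔔 : Quantale) (X Y : QPreordered 𝔔) where
  open RelationCalculus 𝔔
  open PreorderedSubsets 𝔔
  open GaloisConnections 𝔔
  module PX = Presheaves 𝔔 X
  module PY = Presheaves 𝔔 Y
  open PY using (presheaf)
  open Yoneda 𝔔 Y using (yoneda; right-adjoint-below-via-yoneda)
  open DistributorsAsMaps 𝔔 X Y using (from-columns)
  open Setoid (Axialities 𝔔 Y X) using () renaming (_≈_ to _≈ᴳ_)

  axiality : Distributor 𝔔 X Y → Galois 𝔔 (𝖯 𝔔 Y) (𝖯 𝔔 X)
  axiality d = record
    { left = record
        { fun = F ; pres = λ _ → refl
        ; mono = λ μ ν → ⊑⇒≤ (↙-universal {ξ = presheaf ν ⊙ φ} {φ = presheaf μ ⊙ φ} {ψ = presheaf ν ↙ presheaf μ}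
                                (⊑-trans ⊙-assocʳ (⊙-monoˡ ↙-counit))) tt tt }
    ; right = record
        { fun = G ; pres = λ _ → refl
        ; mono = λ μ ν → ⊑⇒≤ (↙-universal {ξ = PX.presheaf ν ↙ φ} {φ = PX.presheaf μ ↙ φ}
                                {ψ = PX.presheaf ν ↙ PX.presheaf μ} ↙-compose) tt tt }
    ; unit = λ μ → PY.≤⇒𝖯-below {μ} {G (F μ)} refl λ y →
        ⊑⇒≤ (↙-universal {ξ = presheaf μ ⊙ φ} {φ = φ} {ψ = presheaf μ} ⊑-refl) y tt
    ; counit = λ ν → PX.≤⇒𝖯-below {F (G ν)} {ν} refl λ x →
        ⊑⇒≤ (↙-counit {ξ = PX.presheaf ν} {φ = φ}) x tt
    }
    where
    φ = ⟦ d ⟧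
    F : PElt 𝔔 Y → PElt 𝔔 X
    F μ = PX.mkPresheaf (presheaf μ ⊙ φ) (⊑-trans ⊙-assocˡ (⊙-monoʳ (⊙-Hom-absorb d)))
    G : PElt 𝔔 X → PElt 𝔔 Y
    G ν = PY.mkPresheaf (PX.presheaf ν ↙ φ) (↙-closedʳ (Hom-⊙-absorb d))

  axiality⁻¹ : Galois 𝔔 (𝖯 𝔔 Y) (𝖯 𝔔 X) → Distributor 𝔔 X Y
  axiality⁻¹ G = from-columns (left G ∘ₘ yoneda)

  axiality⁻¹-axiality : ∀ d x y → ⟦ axiality⁻¹ (axiality d) ⟧ ⟨ x , y ⟩ ≡ ⟦ d ⟧ ⟨ x , y ⟩
  axiality⁻¹-axiality = Hom-⊙-identity

  axiality-unique : ∀ G d → (∀ x y → ⟦ d ⟧ ⟨ x , y ⟩ ≡ ⟦ axiality⁻¹ G ⟧ ⟨ x , y ⟩) → axiality d ≈ᴳ G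
  axiality-unique G d d≈ =
    ≈-from-right-adjoints PY.𝖯-respects-below PX.𝖯-respects-below
      (λ {μ} {ν} → PY.𝖯-antisym {μ} {ν}) (λ {μ} {ν} → PX.𝖯-antisym {μ} {ν}) (axiality d) G
      (right-adjoint-below-via-yoneda PX.𝖯-respects-below (axiality d) G λ y →
        PX.≈⇒𝖯-below {f (yo y)} {f* (yo y)} (agree y))
      (right-adjoint-below-via-yoneda PX.𝖯-respects-below G (axiality d) λ y →
        PX.≈⇒𝖯-above {f (yo y)} {f* (yo y)} (agree y))
    where
    yo = fun yoneda
    f  = fun (left G)
    f* = fun (left (axiality d))
    agree : ∀ y → EqP 𝔔 X (f (yo y)) (f* (yo y))
    agree y = pres (left G) (yo y) , λ x → sym (trans (axiality⁻¹-axiality d x y) (d≈ x y))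

  distributors↔axialities : Inverse (DistSetoid 𝔔 X Y) (Axialities 𝔔 Y X)
  distributors↔axialities = record
    { to = axiality ; from = axiality⁻¹
    ; to-cong = λ {d} {d'} d≈d' → axiality-unique (axiality d') d λ x y →
        trans (d≈d' x y) (sym (axiality⁻¹-axiality d' x y))
    ; from-cong = λ G≈G' x y → proj₂ (proj₁ G≈G' (fun yoneda y)) x
    ; inverse = (λ {G} {d} → axiality-unique G d)
              , (λ {d} G≈ x y → trans (proj₂ (proj₁ G≈ (fun yoneda y)) x) (axiality⁻¹-axiality d x y))
    }

module DistributorsAsDualAxialities (𝔔 : Quantale) (X Y : QPreordered 𝔔) where
  open RelationCalculus 𝔔
  open PreorderedSubsets 𝔔
  open GaloisConnections 𝔔
  module PX = Presheaves 𝔔 X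
  module PY = Presheaves 𝔔 Y
  open PY using (copresheaf)
  open Yoneda 𝔔 X using (yoneda†; left-adjoint-below-via-yoneda†)
  open DistributorsAsMaps 𝔔 X Y using (from-rows)
  open Setoid (DualAxialities 𝔔 Y X) using () renaming (_≈_ to _≈ᴳ_)

  dual-axiality : Distributor 𝔔 X Y → Galois 𝔔 (𝖯† 𝔔 Y) (𝖯† 𝔔 X)
  dual-axiality d = record
    { left = record
        { fun = F ; pres = λ _ → refl
        ; mono = λ κ κ' → ⊑⇒≤ (↘-universal {ψ = φ ↘ copresheaf κ'} {ξ = φ ↘ copresheaf κ}
                                 {φ = copresheaf κ' ↘ copresheaf κ} ↘-compose) tt tt }
    ; right = record
        { fun = G ; pres = λ _ → refl
        ; mono = λ κ κ' → ⊑⇒≤ (↘-universal {ψ = φ ⊙ PX.copresheaf κ'} {ξ = φ ⊙ PX.copresheaf κ}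
                                 {φ = PX.copresheaf κ' ↘ PX.copresheaf κ} (⊑-trans ⊙-assocˡ (⊙-monoʳ ↘-counit))) tt tt }
    ; unit = λ κ → PY.≥⇒𝖯†-below {κ} {G (F κ)} refl λ y →
        ⊑⇒≤ (↘-counit {ψ = φ} {ξ = copresheaf κ}) tt y
    ; counit = λ κ → PX.≥⇒𝖯†-below {F (G κ)} {κ} refl λ x →
        ⊑⇒≤ (↘-universal {ψ = φ} {ξ = φ ⊙ PX.copresheaf κ} {φ = PX.copresheaf κ} ⊑-refl) tt x
    }
    where
    φ = ⟦ d ⟧
    F : P†Elt 𝔔 Y → P†Elt 𝔔 X
    F κ = PX.mkCopresheaf (φ ↘ copresheaf κ) (↘-closedˡ (⊙-Hom-absorb d))
    G : P†Elt 𝔔 X → P†Elt 𝔔 Y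
    G κ = PY.mkCopresheaf (φ ⊙ PX.copresheaf κ) (⊑-trans ⊙-assocʳ (⊙-monoˡ (Hom-⊙-absorb d)))

  dual-axiality⁻¹ : Galois 𝔔 (𝖯† 𝔔 Y) (𝖯† 𝔔 X) → Distributor 𝔔 X Y
  dual-axiality⁻¹ G = from-rows (right G ∘ₘ yoneda†)

  dual-axiality⁻¹-dual-axiality : ∀ d x y → ⟦ dual-axiality⁻¹ (dual-axiality d) ⟧ ⟨ x , y ⟩ ≡ ⟦ d ⟧ ⟨ x , y ⟩
  dual-axiality⁻¹-dual-axiality = ⊙-Hom-identity

  dual-axiality-unique : ∀ G d → (∀ x y → ⟦ d ⟧ ⟨ x , y ⟩ ≡ ⟦ dual-axiality⁻¹ G ⟧ ⟨ x , y ⟩) → dual-axiality d ≈ᴳ G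
  dual-axiality-unique G d d≈ =
    ≈-from-left-adjoints PY.𝖯†-respects-below PX.𝖯†-respects-below
      (λ {κ} {κ'} → PY.𝖯†-antisym {κ} {κ'}) (λ {κ} {κ'} → PX.𝖯†-antisym {κ} {κ'}) (dual-axiality d) G
      (left-adjoint-below-via-yoneda† PY.𝖯†-respects-below (dual-axiality d) G λ x →
        PY.≈⇒𝖯†-below {g (yo† x)} {g* (yo† x)} (agree x))
      (left-adjoint-below-via-yoneda† PY.𝖯†-respects-below G (dual-axiality d) λ x →
        PY.≈⇒𝖯†-above {g (yo† x)} {g* (yo† x)} (agree x))
    where
    yo† = fun yoneda†
    g   = fun (right G)
    g*  = fun (right (dual-axiality d))
    agree : ∀ x → EqP† 𝔔 Y (g (yo† x)) (g* (yo† x))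
    agree x = pres (right G) (yo† x) , λ y → sym (trans (dual-axiality⁻¹-dual-axiality d x y) (d≈ x y))

  distributors↔dual-axialities : Inverse (DistSetoid 𝔔 X Y) (DualAxialities 𝔔 Y X)
  distributors↔dual-axialities = record
    { to = dual-axiality ; from = dual-axiality⁻¹
    ; to-cong = λ {d} {d'} d≈d' → dual-axiality-unique (dual-axiality d') d λ x y →
        trans (d≈d' x y) (sym (dual-axiality⁻¹-dual-axiality d' x y))
    ; from-cong = λ G≈G' x y → proj₂ (proj₂ G≈G' (fun yoneda† x)) y
    ; inverse = (λ {G} {d} → dual-axiality-unique G d)
              , (λ {d} G≈ x y → trans (proj₂ (proj₂ G≈ (fun yoneda† x)) y) (dual-axiality⁻¹-dual-axiality d x y))
    }

theorem4p24 : (𝔔 : Quantale) → Nontrivial 𝔔 → (X Y : QPreordered 𝔔) →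
    Inverse (DistSetoid 𝔔 X Y) (MapsToP 𝔔 X Y)
    × Inverse (DistSetoid 𝔔 X Y) (MapsToP† 𝔔 X Y)
    × Inverse (DistSetoid 𝔔 X Y) (Polarities 𝔔 X Y)
    × Inverse (DistSetoid 𝔔 X Y) (Axialities 𝔔 Y X)
    × Inverse (DistSetoid 𝔔 X Y) (DualAxialities 𝔔 Y X)
theorem4p24 𝔔 _ X Y =
    DistributorsAsMaps.distributors↔columns 𝔔 X Y
  , DistributorsAsMaps.distributors↔rows 𝔔 X Y
  , DistributorsAsPolarities.distributors↔polarities 𝔔 X Y
  , DistributorsAsAxialities.distributors↔axialities 𝔔 X Y
  , DistributorsAsDualAxialities.distributors↔dual-axialities 𝔔 X Y
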